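{- Let $n$ be a positive integer and let $k$ be an integer with $|k|\geq 2$. Then $n\,\tau_k(n+1)\equiv 0\pmod{|k|}$.
   Context: For a nonzero integer $k$, the arithmetical function $\tau_k$ is defined by $q\prod_{m=1}^{\infty}(1-q^m)^k=\sum_{n=1}^{\infty}\tau_k(n)q^n$. -}

module Defs where

open import Data.Nat as ℕ using (ℕ; zero; suc)
open import Data.Bool using (Bool; true; false; if_then_else_)
open import Data.Integer as ℤ using (ℤ; +_; -[1+_]; _+_; _*_; -_)
open import Data.List using (List; []; _∷_; map; upTo)

-- Formal power series over ℤ, represented by their coefficient sequence.
Series : Set
Series = ℕ → ℤ

sumℤ : List ℤ → ℤ
sumℤ []       = + 0
sumℤ (x ∷ xs) = x + sumℤ xs

_⋆_ : Series → Series → Series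
(f ⋆ g) d = sumℤ (map (λ i → f i * g (d ℕ.∸ i)) (upTo (suc d)))

one : Series
one zero    = + 1
one (suc _) = + 0

-- the polynomial 1 - q^(suc j)   (i.e. 1 - q^m with m = suc j ≥ 1)
oneMinusQ : ℕ → Series
oneMinusQ j zero    = + 1
oneMinusQ j (suc d) = if d ℕ.≡ᵇ j then - (+ 1) else + 0

-- its inverse in ℤ[[q]]: 1/(1 - q^(suc j)) = Σ_{t ≥ 0} q^((suc j) t)
geomQ : ℕ → Series
geomQ j d = if d ℕ.% suc j ℕ.≡ᵇ 0 then + 1 else + 0

pow : Series → ℕ → Series
pow f zero    = one
pow f (suc r) = f ⋆ pow f r

factor : ℤ → ℕ → Series
factor (+ r)    j = pow (oneMinusQ j) r
factor -[1+ r ] j = pow (geomQ j) (suc r)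

partialProd : ℤ → ℕ → Series
partialProd k zero    = one
partialProd k (suc N) = factor k N ⋆ partialProd k N

-- The coefficient of q^d in ∏_{m=1}^∞ (1 - q^m)^k.  Factors with m > d
-- do not affect the coefficient of q^d, so the product up to m = d suffices.
etaCoeff : ℤ → ℕ → ℤ
etaCoeff k d = partialProd k d d

-- τ_k(n) : q ∏ (1 - q^m)^k = Σ_{n ≥ 1} τ_k(n) q^n, so τ_k(n) = etaCoeff k (n-1)
-- for n ≥ 1 (and τ_k(0) = 0).
τ : ℤ → ℕ → ℤ
τ k zero    = + 0
τ k (suc n) = etaCoeff k n

-- Let θ = q d/dq.  It is a derivation of ℤ[[q]], so θ (g ^ r) = r g ^ (r - 1) θ g and
-- |k| divides every coefficient of θ of each factor (1 - q^m)^k: for k ≥ 0 this is the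
-- power rule for g = 1 - q^m, for k < 0 it is the power rule for g = 1/(1 - q^m) with
-- r = |k|.  By the Leibniz rule the same divisibility passes to the whole product, whose
-- image under θ has n τ_k(n+1) as its coefficient of q^n.
module Submission where

open import Defs
open import Data.Nat using (ℕ; suc; _≤_; _>_)
open import Data.Integer using (ℤ; +_; _*_; ∣_∣)
open import Data.Integer.Divisibility using (_∣_)

open import Data.Nat using (zero; _∸_)
open import Data.Integer using (-[1+_]; _+_)
open import Data.Integer.Properties using (*-zeroˡ; *-zeroʳ)
open import Data.Integer.Tactic.RingSolver using (solve-∀)
import Data.Integer.Divisibility.Signed as Signed
open import Data.List using (map; applyUpTo)
open import Data.List.Properties using (map-applyUpTo)
open import Function using (_∘_; id)
open import Relation.Binary.PropositionalEquality

tail : Series → Series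
tail f n = f (suc n)

𝟘 : Series
𝟘 _ = + 0

_⊕_ : Series → Series → Series
(f ⊕ g) d = f d + g d

_·ˢ_ : ℤ → Series → Series
(c ·ˢ f) d = c * f d

θ : Series → Series
θ f d = + d * f d

⋆-suc : ∀ f g d → (f ⋆ g) (suc d) ≡ f 0 * g (suc d) + (tail f ⋆ g) d
⋆-suc f g d = cong (λ l → f 0 * g (suc d) + sumℤ l)
  (trans (map-applyUpTo suc term (suc d)) (sym (map-applyUpTo id tailTerm (suc d))))
  where
  term tailTerm : ℕ → ℤ
  term i = f i * g (suc d ∸ i)
  tailTerm i = f (suc i) * g (d ∸ i)

⋆-sucʳ : ∀ f g d → (f ⋆ g) (suc d) ≡ (f ⋆ tail g) d + f (suc d) * g 0
⋆-sucʳ f g zero = trans (⋆-suc f g 0) (shift (f 0 * g 1) (f 1 * g 0))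
  where
  shift : ∀ a b → a + (b + + 0) ≡ (a + + 0) + b
  shift = solve-∀
⋆-sucʳ f g (suc d) = begin
  (f ⋆ g) (suc (suc d))                                    ≡⟨ ⋆-suc f g (suc d) ⟩
  f 0 * g (suc (suc d)) + (tail f ⋆ g) (suc d)             ≡⟨ cong (_+_ (f 0 * g (suc (suc d)))) (⋆-sucʳ (tail f) g d) ⟩
  f 0 * g (suc (suc d)) + ((tail f ⋆ tail g) d + last)     ≡⟨ shift (f 0 * g (suc (suc d))) _ last ⟩
  (f 0 * g (suc (suc d)) + (tail f ⋆ tail g) d) + last     ≡⟨ cong (_+ last) (⋆-suc f (tail g) d) ⟨
  (f ⋆ tail g) (suc d) + last                              ∎
  where
  open ≡-Reasoning
  last = f (suc (suc d)) * g 0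
  shift : ∀ a x y → a + (x + y) ≡ (a + x) + y
  shift = solve-∀

⋆-cong : ∀ {f f′ g g′} → f ≗ f′ → g ≗ g′ → f ⋆ g ≗ f′ ⋆ g′
⋆-cong p q zero = cong₂ (λ a b → a * b + + 0) (p 0) (q 0)
⋆-cong {f} {f′} {g} {g′} p q (suc d) = begin
  (f ⋆ g) (suc d)                          ≡⟨ ⋆-suc f g d ⟩
  f 0 * g (suc d) + (tail f ⋆ g) d         ≡⟨ cong₂ _+_ (cong₂ _*_ (p 0) (q (suc d))) (⋆-cong {tail f} {tail f′} {g} {g′} (p ∘ suc) q d) ⟩
  f′ 0 * g′ (suc d) + (tail f′ ⋆ g′) d     ≡⟨ ⋆-suc f′ g′ d ⟨
  (f′ ⋆ g′) (suc d)                        ∎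
  where open ≡-Reasoning

⋆-congˡ : ∀ {f f′} g → f ≗ f′ → f ⋆ g ≗ f′ ⋆ g
⋆-congˡ {f} {f′} g p = ⋆-cong {f} {f′} {g} {g} p (λ _ → refl)

⋆-congʳ : ∀ f {g g′} → g ≗ g′ → f ⋆ g ≗ f ⋆ g′
⋆-congʳ f {g} {g′} q = ⋆-cong {f} {f} {g} {g′} (λ _ → refl) q

⋆-zeroʳ : ∀ f → f ⋆ 𝟘 ≗ 𝟘
⋆-zeroʳ f zero = cong (_+ + 0) (*-zeroʳ (f 0))
⋆-zeroʳ f (suc d) = begin
  (f ⋆ 𝟘) (suc d)                    ≡⟨ ⋆-suc f 𝟘 d ⟩
  f 0 * + 0 + (tail f ⋆ 𝟘) d         ≡⟨ cong₂ _+_ (*-zeroʳ (f 0)) (⋆-zeroʳ (tail f) d) ⟩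
  + 0                                ∎
  where open ≡-Reasoning

⋆-distribʳ-⊕ : ∀ f g h → (f ⊕ g) ⋆ h ≗ (f ⋆ h) ⊕ (g ⋆ h)
⋆-distribʳ-⊕ f g h zero = distrib (f 0) (g 0) (h 0) (+ 0) (+ 0)
  where
  distrib : ∀ a b c x y → (a + b) * c + (x + y) ≡ (a * c + x) + (b * c + y)
  distrib = solve-∀
⋆-distribʳ-⊕ f g h (suc d) = begin
  ((f ⊕ g) ⋆ h) (suc d)                                             ≡⟨ ⋆-suc (f ⊕ g) h d ⟩
  (f 0 + g 0) * h (suc d) + ((tail f ⊕ tail g) ⋆ h) d               ≡⟨ cong (_+_ ((f 0 + g 0) * h (suc d))) (⋆-distribʳ-⊕ (tail f) (tail g) h d) ⟩
  (f 0 + g 0) * h (suc d) + ((tail f ⋆ h) d + (tail g ⋆ h) d)       ≡⟨ distrib (f 0) (g 0) (h (suc d)) _ _ ⟩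
  (f 0 * h (suc d) + (tail f ⋆ h) d) + (g 0 * h (suc d) + (tail g ⋆ h) d)
                                                                    ≡⟨ cong₂ _+_ (⋆-suc f h d) (⋆-suc g h d) ⟨
  ((f ⋆ h) ⊕ (g ⋆ h)) (suc d)                                       ∎
  where
  open ≡-Reasoning
  distrib : ∀ a b c x y → (a + b) * c + (x + y) ≡ (a * c + x) + (b * c + y)
  distrib = solve-∀

·ˢ-⋆-assoc : ∀ c f g → (c ·ˢ f) ⋆ g ≗ c ·ˢ (f ⋆ g)
·ˢ-⋆-assoc c f g zero = pull c (f 0) (g 0)
  where
  pull : ∀ c a b → c * a * b + + 0 ≡ c * (a * b + + 0)
  pull = solve-∀
·ˢ-⋆-assoc c f g (suc d) = begin
  ((c ·ˢ f) ⋆ g) (suc d)                            ≡⟨ ⋆-suc (c ·ˢ f) g d ⟩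
  c * f 0 * g (suc d) + ((c ·ˢ tail f) ⋆ g) d       ≡⟨ cong (_+_ (c * f 0 * g (suc d))) (·ˢ-⋆-assoc c (tail f) g d) ⟩
  c * f 0 * g (suc d) + c * (tail f ⋆ g) d          ≡⟨ pull c (f 0) (g (suc d)) _ ⟩
  c * (f 0 * g (suc d) + (tail f ⋆ g) d)            ≡⟨ cong (c *_) (⋆-suc f g d) ⟨
  (c ·ˢ (f ⋆ g)) (suc d)                            ∎
  where
  open ≡-Reasoning
  pull : ∀ c a b x → c * a * b + c * x ≡ c * (a * b + x)
  pull = solve-∀

⋆-comm : ∀ f g → f ⋆ g ≗ g ⋆ f
⋆-comm f g zero = swap (f 0) (g 0) (+ 0)
  where
  swap : ∀ a b x → a * b + x ≡ b * a + x
  swap = solve-∀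
⋆-comm f g (suc d) = begin
  (f ⋆ g) (suc d)                       ≡⟨ ⋆-suc f g d ⟩
  f 0 * g (suc d) + (tail f ⋆ g) d      ≡⟨ cong (_+_ (f 0 * g (suc d))) (⋆-comm (tail f) g d) ⟩
  f 0 * g (suc d) + (g ⋆ tail f) d      ≡⟨ swap (f 0) (g (suc d)) _ ⟩
  (g ⋆ tail f) d + g (suc d) * f 0      ≡⟨ ⋆-sucʳ g f d ⟨
  (g ⋆ f) (suc d)                       ∎
  where
  open ≡-Reasoning
  swap : ∀ a b x → a * b + x ≡ x + b * a
  swap = solve-∀

⋆-assoc : ∀ f g h → (f ⋆ g) ⋆ h ≗ f ⋆ (g ⋆ h)
⋆-assoc f g h zero = reassoc (f 0) (g 0) (h 0)
  where
  reassoc : ∀ a b c → (a * b + + 0) * c + + 0 ≡ a * (b * c + + 0) + + 0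
  reassoc = solve-∀
⋆-assoc f g h (suc d) = begin
  ((f ⋆ g) ⋆ h) (suc d)                                          ≡⟨ ⋆-suc (f ⋆ g) h d ⟩
  (f ⋆ g) 0 * h (suc d) + (tail (f ⋆ g) ⋆ h) d                   ≡⟨ cong (_+_ ((f ⋆ g) 0 * h (suc d))) tailStep ⟩
  (f 0 * g 0 + + 0) * h (suc d) + (f 0 * (tail g ⋆ h) d + (tail f ⋆ (g ⋆ h)) d)
                                                                 ≡⟨ reassoc (f 0) (g 0) (h (suc d)) _ _ ⟩
  f 0 * (g 0 * h (suc d) + (tail g ⋆ h) d) + (tail f ⋆ (g ⋆ h)) d
                                                                 ≡⟨ cong (λ x → f 0 * x + (tail f ⋆ (g ⋆ h)) d) (⋆-suc g h d) ⟨
  f 0 * (g ⋆ h) (suc d) + (tail f ⋆ (g ⋆ h)) d                   ≡⟨ ⋆-suc f (g ⋆ h) d ⟨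
  (f ⋆ (g ⋆ h)) (suc d)                                          ∎
  where
  open ≡-Reasoning
  reassoc : ∀ a b c y z → (a * b + + 0) * c + (a * y + z) ≡ a * (b * c + y) + z
  reassoc = solve-∀
  tailStep : (tail (f ⋆ g) ⋆ h) d ≡ f 0 * (tail g ⋆ h) d + (tail f ⋆ (g ⋆ h)) d
  tailStep = begin
    (tail (f ⋆ g) ⋆ h) d                                  ≡⟨ ⋆-congˡ h (⋆-suc f g) d ⟩
    (((f 0 ·ˢ tail g) ⊕ (tail f ⋆ g)) ⋆ h) d              ≡⟨ ⋆-distribʳ-⊕ (f 0 ·ˢ tail g) (tail f ⋆ g) h d ⟩
    ((f 0 ·ˢ tail g) ⋆ h) d + ((tail f ⋆ g) ⋆ h) d        ≡⟨ cong₂ _+_ (·ˢ-⋆-assoc (f 0) (tail g) h d) (⋆-assoc (tail f) g h d) ⟩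
    f 0 * (tail g ⋆ h) d + (tail f ⋆ (g ⋆ h)) d           ∎

⋆-·ˢ-comm : ∀ c f g → f ⋆ (c ·ˢ g) ≗ c ·ˢ (f ⋆ g)
⋆-·ˢ-comm c f g d = begin
  (f ⋆ (c ·ˢ g)) d    ≡⟨ ⋆-comm f (c ·ˢ g) d ⟩
  ((c ·ˢ g) ⋆ f) d    ≡⟨ ·ˢ-⋆-assoc c g f d ⟩
  c * (g ⋆ f) d       ≡⟨ cong (c *_) (⋆-comm g f d) ⟩
  c * (f ⋆ g) d       ∎
  where open ≡-Reasoning

⋆-leftComm : ∀ f g h → f ⋆ (g ⋆ h) ≗ g ⋆ (f ⋆ h)
⋆-leftComm f g h d = begin
  (f ⋆ (g ⋆ h)) d     ≡⟨ ⋆-assoc f g h d ⟨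
  ((f ⋆ g) ⋆ h) d     ≡⟨ ⋆-congˡ h (⋆-comm f g) d ⟩
  ((g ⋆ f) ⋆ h) d     ≡⟨ ⋆-assoc g f h d ⟩
  (g ⋆ (f ⋆ h)) d     ∎
  where open ≡-Reasoning

θ-one : θ one ≗ 𝟘
θ-one zero    = refl
θ-one (suc n) = *-zeroʳ (+ suc n)

tail-θ : ∀ f → tail (θ f) ≗ θ (tail f) ⊕ tail f
tail-θ f n = succ (+ n) (f (suc n))
  where
  succ : ∀ e x → (+ 1 + e) * x ≡ e * x + x
  succ = solve-∀

θ-⋆ : ∀ f g → θ (f ⋆ g) ≗ (θ f ⋆ g) ⊕ (f ⋆ θ g)
θ-⋆ f g zero = spread (f 0) (g 0)
  where
  spread : ∀ a b → + 0 * (a * b + + 0) ≡ (+ 0 * a * b + + 0) + (a * (+ 0 * b) + + 0)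
  spread = solve-∀
θ-⋆ f g (suc d) = begin
  + suc d * (f ⋆ g) (suc d)                                ≡⟨ cong (+ suc d *_) (⋆-suc f g d) ⟩
  (+ 1 + + d) * (f 0 * g (suc d) + B)                      ≡⟨ expand (+ d) (f 0) (g (suc d)) B ⟩
  (+ d * B + B) + f 0 * θ g (suc d)                        ≡⟨ cong (λ x → (x + B) + f 0 * θ g (suc d)) (θ-⋆ (tail f) g d) ⟩
  ((X + Y) + B) + f 0 * θ g (suc d)                        ≡⟨ regroup (+ d) (f 0) (g (suc d)) B X Y ⟩
  (+ 0 * f 0 * g (suc d) + (X + B)) + (f 0 * θ g (suc d) + Y)
                                                           ≡⟨ cong (λ x → (+ 0 * f 0 * g (suc d) + x) + (f 0 * θ g (suc d) + Y)) tailStep ⟨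
  (+ 0 * f 0 * g (suc d) + (tail (θ f) ⋆ g) d) + (f 0 * θ g (suc d) + Y)
                                                           ≡⟨ cong₂ _+_ (⋆-suc (θ f) g d) (⋆-suc f (θ g) d) ⟨
  ((θ f ⋆ g) ⊕ (f ⋆ θ g)) (suc d)                          ∎
  where
  open ≡-Reasoning
  B = (tail f ⋆ g) d
  X = (θ (tail f) ⋆ g) d
  Y = (tail f ⋆ θ g) d
  expand : ∀ e a b x → (+ 1 + e) * (a * b + x) ≡ (e * x + x) + a * ((+ 1 + e) * b)
  expand = solve-∀
  regroup : ∀ e a b x y z → ((y + z) + x) + a * ((+ 1 + e) * b)
                          ≡ (+ 0 * a * b + (y + x)) + (a * ((+ 1 + e) * b) + z)
  regroup = solve-∀
  tailStep : (tail (θ f) ⋆ g) d ≡ X + B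
  tailStep = trans (⋆-congˡ g (tail-θ f) d) (⋆-distribʳ-⊕ (θ (tail f)) (tail f) g d)

θ-pow : ∀ g r → θ (pow g (suc r)) ≗ (+ suc r) ·ˢ (θ g ⋆ pow g r)
θ-pow g zero d = begin
  θ (g ⋆ one) d                           ≡⟨ θ-⋆ g one d ⟩
  (θ g ⋆ one) d + (g ⋆ θ one) d           ≡⟨ cong (_+_ ((θ g ⋆ one) d)) (trans (⋆-congʳ g θ-one d) (⋆-zeroʳ g d)) ⟩
  (θ g ⋆ one) d + + 0                     ≡⟨ unit ((θ g ⋆ one) d) ⟩
  + 1 * (θ g ⋆ one) d                     ∎
  where
  open ≡-Reasoning
  unit : ∀ x → x + + 0 ≡ + 1 * x
  unit = solve-∀
θ-pow g (suc r) d = begin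
  θ (g ⋆ P) d                             ≡⟨ θ-⋆ g P d ⟩
  (θ g ⋆ P) d + (g ⋆ θ P) d               ≡⟨ cong (_+_ ((θ g ⋆ P) d)) innerStep ⟩
  (θ g ⋆ P) d + c * (θ g ⋆ P) d           ≡⟨ collect c ((θ g ⋆ P) d) ⟩
  (+ 1 + c) * (θ g ⋆ P) d                 ∎
  where
  open ≡-Reasoning
  P = pow g (suc r)
  Q = pow g r
  c = + suc r
  collect : ∀ c x → x + c * x ≡ (+ 1 + c) * x
  collect = solve-∀
  innerStep : (g ⋆ θ P) d ≡ c * (θ g ⋆ P) d
  innerStep = begin
    (g ⋆ θ P) d                  ≡⟨ ⋆-congʳ g (θ-pow g r) d ⟩
    (g ⋆ (c ·ˢ (θ g ⋆ Q))) d     ≡⟨ ⋆-·ˢ-comm c g (θ g ⋆ Q) d ⟩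
    c * (g ⋆ (θ g ⋆ Q)) d        ≡⟨ cong (c *_) (⋆-leftComm g (θ g) Q d) ⟩
    c * (θ g ⋆ P) d              ∎

_∣ˢ_ : ℤ → Series → Set
m ∣ˢ f = ∀ d → m Signed.∣ f d

∣ˢ-⋆ : ∀ {m} f g → m ∣ˢ f → m ∣ˢ (f ⋆ g)
∣ˢ-⋆ {m} f g m∣f zero = Signed.∣m∣n⇒∣m+n (Signed.∣m⇒∣m*n (g 0) (m∣f 0)) (Signed.divides (+ 0) (sym (*-zeroˡ m)))
∣ˢ-⋆ {m} f g m∣f (suc d) = subst (m Signed.∣_) (sym (⋆-suc f g d))
  (Signed.∣m∣n⇒∣m+n (Signed.∣m⇒∣m*n (g (suc d)) (m∣f 0)) (∣ˢ-⋆ (tail f) g (m∣f ∘ suc) d))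

∣ˢ-θ-⋆ : ∀ {m} f g → m ∣ˢ θ f → m ∣ˢ θ g → m ∣ˢ θ (f ⋆ g)
∣ˢ-θ-⋆ {m} f g m∣θf m∣θg d = subst (m Signed.∣_) (sym (θ-⋆ f g d))
  (Signed.∣m∣n⇒∣m+n (∣ˢ-⋆ (θ f) g m∣θf d)
                    (subst (m Signed.∣_) (⋆-comm (θ g) f d) (∣ˢ-⋆ (θ g) f m∣θg d)))

∣ˢ-θ-one : ∀ m → m ∣ˢ θ one
∣ˢ-θ-one m d = subst (m Signed.∣_) (sym (θ-one d)) (Signed.divides (+ 0) (sym (*-zeroˡ m)))

∣ˢ-θ-pow : ∀ g r → (+ r) ∣ˢ θ (pow g r)
∣ˢ-θ-pow g zero    = ∣ˢ-θ-one (+ 0)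
∣ˢ-θ-pow g (suc r) d = subst (+ suc r Signed.∣_) (sym (θ-pow g r d)) (Signed.∣m⇒∣m*n _ Signed.∣-refl)

∣ˢ-θ-factor : ∀ k j → (+ ∣ k ∣) ∣ˢ θ (factor k j)
∣ˢ-θ-factor (+ r)    j = ∣ˢ-θ-pow (oneMinusQ j) r
∣ˢ-θ-factor -[1+ r ] j = ∣ˢ-θ-pow (geomQ j) (suc r)

∣ˢ-θ-partialProd : ∀ k N → (+ ∣ k ∣) ∣ˢ θ (partialProd k N)
∣ˢ-θ-partialProd k zero    = ∣ˢ-θ-one _
∣ˢ-θ-partialProd k (suc N) =
  ∣ˢ-θ-⋆ (factor k N) (partialProd k N) (∣ˢ-θ-factor k N) (∣ˢ-θ-partialProd k N)

-- The hypotheses n > 0 and 2 ≤ |k| are unused: the divisibility holds for all n and k.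
mainTheorem4 : (n : ℕ) → n > 0 → (k : ℤ) → 2 ≤ ∣ k ∣ →
               (+ ∣ k ∣) ∣ ((+ n) * τ k (suc n))
mainTheorem4 n _ k _ = Signed.∣⇒∣ᵤ (∣ˢ-θ-partialProd k n n)
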